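{- Let $V$ be a finite set of Boolean variables, $\Phi$ a propositional formula over $V$, $\psi$ a specification, and $\gamma$ a generalizer. If $\gamma$ is proper (with respect to $\Phi$ and $\psi$), then every execution of $\mathrm{GCG}(\Phi,\psi,\gamma)$ terminates, whatever satisfying assignments are chosen in its guessing steps.
   Context: Setting. Each assignment $\sigma:V\to\{0,1\}$ determines a model $M_\sigma$ (e.g. a labeled transition system), and $\psi$ is a specification with a satisfaction relation, written $M\models\psi$ / $M\not\models\psi$. For an assignment $\sigma$ and a formula $\varphi$ over $V$, $\sigma\models\varphi$ means $\sigma$ satisfies $\varphi$. An assignment $\sigma$ is also identified with the formula satisfied by $\sigma$ and by no other assignment, so $\neg\sigma$ is satisfied by all assignments except $\sigma$. A generalizer is a function $\gamma$ mapping assignments to propositional formulas over $V$. It is proper (with respect to the input formula $\Phi$ and $\psi$) if for every $\sigma$ with $\sigma\models\Phi$ and $M_\sigma\not\models\psi$: (i) $\sigma\models\gamma(\sigma)$ (self-inclusion); and (ii) for every $\rho$ with $\rho\models\Phi$ and $M_\rho\models\psi$, we have $\rho\not\models\gamma(\sigma)$ (correct-exclusion). Algorithm $\mathrm{GCG}(\Phi,\psi,\gamma)$ (enumeration mode). Keep a current formula $\Phi_{cur}$, initialized to $\Phi$. While $\Phi_{cur}$ is satisfiable: - pick an arbitrary assignment $\sigma$ with $\sigma\models\Phi_{cur}$ (a "candidate"); - if $M_\sigma\models\psi$, output $\sigma$ (a "solution") and set $\Phi_{cur}:=\Phi_{cur}\wedge\neg\sigma$; - otherwise set $\Phi_{cur}:=\Phi_{cur}\wedge\neg\gamma(\sigma)$.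 -}

module Defs where

open import Data.Nat using (ℕ)
open import Data.Fin using (Fin)
open import Data.Bool using (Bool; true; false; _∧_; _∨_; not)
open import Data.List using (foldr; allFin)
open import Data.Product using (_×_; Σ; ∃)
open import Data.Sum using (_⊎_)
open import Relation.Nullary using (¬_)
open import Relation.Binary.PropositionalEquality using (_≡_)

-- The variable set V is Fin n (an arbitrary finite set of n Boolean variables).
Assignment : ℕ → Set
Assignment n = Fin n → Bool

data Formula (n : ℕ) : Set where
  var  : Fin n → Formula n
  tt   : Formula n
  ff   : Formula n
  neg  : Formula n → Formula n
  _and_ : Formula n → Formula n → Formula n
  _or_  : Formula n → Formula n → Formula n

⟦_⟧ : ∀ {n} → Formula n → Assignment n → Bool
⟦ var i ⟧ σ = σ i
⟦ tt ⟧ σ = true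
⟦ ff ⟧ σ = false
⟦ neg φ ⟧ σ = not (⟦ φ ⟧ σ)
⟦ φ and ψ ⟧ σ = ⟦ φ ⟧ σ ∧ ⟦ ψ ⟧ σ
⟦ φ or ψ ⟧ σ = ⟦ φ ⟧ σ ∨ ⟦ ψ ⟧ σ

_⊨_ : ∀ {n} → Assignment n → Formula n → Set
σ ⊨ φ = ⟦ φ ⟧ σ ≡ true

-- The formula identified with an assignment σ (its minterm): satisfied by σ only.
literal : ∀ {n} → Fin n → Bool → Formula n
literal i true  = var i
literal i false = neg (var i)

minterm : ∀ {n} → Assignment n → Formula n
minterm {n} σ = foldr (λ i φ → literal i (σ i) and φ) tt (allFin n)

-- A specification ψ together with the models M_σ is abstracted as the
-- predicate  Holds σ  :=  "M_σ ⊨ ψ".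

Proper : ∀ {n} → Formula n → (Assignment n → Set) → (Assignment n → Formula n) → Set
Proper {n} Φ Holds γ =
  ∀ (σ : Assignment n) → σ ⊨ Φ → ¬ Holds σ →
    (σ ⊨ γ σ) × (∀ (ρ : Assignment n) → ρ ⊨ Φ → Holds ρ → ¬ (ρ ⊨ γ σ))

-- One loop iteration of GCG (enumeration mode): from Φcur, pick any σ ⊨ Φcur
-- (so Φcur is satisfiable) and move to the next current formula.
data GCGStep {n} (Holds : Assignment n → Set) (γ : Assignment n → Formula n)
             (Φcur : Formula n) : Formula n → Set where
  solution : (σ : Assignment n) → σ ⊨ Φcur → Holds σ →
             GCGStep Holds γ Φcur (Φcur and neg (minterm σ))
  generalize : (σ : Assignment n) → σ ⊨ Φcur → ¬ Holds σ →
             GCGStep Holds γ Φcur (Φcur and neg (γ σ))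

GCGSucc : ∀ {n} → (Assignment n → Set) → (Assignment n → Formula n) →
          Formula n → Formula n → Set
GCGSucc Holds γ Φ' Φcur = GCGStep Holds γ Φcur Φ'

{-# OPTIONS --safe #-}
-- Every step of GCG conjoins the current formula with the negation of a formula
-- satisfied by the chosen candidate σ: by σ itself for a solution, and by γ σ for a
-- non-solution, thanks to self-inclusion (σ satisfies the current formula, which
-- entails Φ).  So σ is removed from the models of the current formula and no model is
-- added, and the number of models, bounded by 2ⁿ, strictly decreases at every step.
module Submission where

open import Defs
open import Data.Nat using (ℕ; zero; suc; _+_; _≤_; _<_; z≤n; s≤s)
open import Data.Nat.Properties using (≤-refl; +-mono-≤; +-mono-≤-<; +-mono-<-≤)
open import Data.Nat.Induction using (<-wellFounded)
open import Induction.WellFounded using (Acc; acc)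
open import Data.Bool using (Bool; true; false; _∧_; _∨_; not; if_then_else_)
open import Data.Fin using (Fin)
open import Data.List using (List; []; _∷_; foldr; allFin)
open import Data.Vec.Functional using (head; tail) renaming ([] to []ᵛ; _∷_ to _∷ᵛ_)
open import Data.Vec.Functional.Properties using (∷-cong)
open import Data.Product using (_×_; _,_; proj₁)
open import Function using (_∘_)
open import Relation.Binary.Core using (Rel; _Preserves_⟶_)
open import Relation.Binary.PropositionalEquality using (_≡_; refl; trans; cong; cong₂; _≗_)

private
  variable
    n : ℕ

acc-by-measure : ∀ {a ℓ p} {A : Set a} {_≺_ : Rel A ℓ} (μ : A → ℕ) (P : A → Set p) →
                 (∀ {x y} → P x → y ≺ x → P y × μ y < μ x) →
                 ∀ {x} → P x → Acc _≺_ x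
acc-by-measure {_≺_ = _≺_} μ P step {x} px = go px (<-wellFounded (μ x))
  where
  go : ∀ {x} → P x → Acc _<_ (μ x) → Acc _≺_ x
  go px (acc rs) = acc λ y≺x → let py , μy<μx = step px y≺x in go py (rs μy<μx)

count : (n : ℕ) → (Assignment n → Bool) → ℕ
count zero    f = if f []ᵛ then 1 else 0
count (suc n) f = count n (f ∘ (false ∷ᵛ_)) + count n (f ∘ (true ∷ᵛ_))

_⊆_ : (f g : Assignment n → Bool) → Set
f ⊆ g = ∀ σ → f σ ≡ true → g σ ≡ true

count-mono : ∀ n {f g : Assignment n → Bool} → f ⊆ g → count n f ≤ count n g
count-mono zero {f} f⊆g with f []ᵛ in e
... | false = z≤n
... | true rewrite f⊆g []ᵛ e = ≤-refl
count-mono (suc n) f⊆g =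
  +-mono-≤ (count-mono n (f⊆g ∘ (false ∷ᵛ_))) (count-mono n (f⊆g ∘ (true ∷ᵛ_)))

count-mono-< : ∀ n {f g : Assignment n → Bool} →
               f Preserves _≗_ ⟶ _≡_ → g Preserves _≗_ ⟶ _≡_ → f ⊆ g →
               ∀ σ → f σ ≡ false → g σ ≡ true → count n f < count n g
count-mono-< zero fr gr f⊆g σ fσ gσ
  rewrite fr {[]ᵛ} {σ} (λ ()) | gr {[]ᵛ} {σ} (λ ()) | fσ | gσ = s≤s z≤n
count-mono-< (suc n) {f} {g} fr gr f⊆g σ fσ gσ =
  at-head (head σ)
    (count-mono-< n (fr ∘ ∷-cong refl) (gr ∘ ∷-cong refl) (f⊆g ∘ (head σ ∷ᵛ_))
       (tail σ) (trans (fr σ≗) fσ) (trans (gr σ≗) gσ))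
  where
  σ≗ : head σ ∷ᵛ tail σ ≗ σ
  σ≗ = ∷-cong refl λ _ → refl

  at-head : ∀ b → count n (f ∘ (b ∷ᵛ_)) < count n (g ∘ (b ∷ᵛ_)) →
            count (suc n) f < count (suc n) g
  at-head false lt = +-mono-<-≤ lt (count-mono n (f⊆g ∘ (true ∷ᵛ_)))
  at-head true  lt = +-mono-≤-< (count-mono n (f⊆g ∘ (false ∷ᵛ_))) lt

⟦⟧-cong : (φ : Formula n) → ⟦ φ ⟧ Preserves _≗_ ⟶ _≡_
⟦⟧-cong (var i)   σ≗τ = σ≗τ i
⟦⟧-cong tt        σ≗τ = refl
⟦⟧-cong ff        σ≗τ = refl
⟦⟧-cong (neg φ)   σ≗τ = cong not (⟦⟧-cong φ σ≗τ)
⟦⟧-cong (φ and ψ) σ≗τ = cong₂ _∧_ (⟦⟧-cong φ σ≗τ) (⟦⟧-cong ψ σ≗τ)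
⟦⟧-cong (φ or ψ)  σ≗τ = cong₂ _∨_ (⟦⟧-cong φ σ≗τ) (⟦⟧-cong ψ σ≗τ)

∧-elimˡ : ∀ {a b} → a ∧ b ≡ true → a ≡ true
∧-elimˡ {true} _ = refl

literal-self : (σ : Assignment n) (i : Fin n) → σ ⊨ literal i (σ i)
literal-self σ i with σ i in e
... | true  = e
... | false = cong not e

minterm-self : (σ : Assignment n) → σ ⊨ minterm σ
minterm-self {n} σ = conj (allFin n)
  where
  conj : (is : List (Fin n)) → ⟦ foldr (λ i φ → literal i (σ i) and φ) tt is ⟧ σ ≡ true
  conj []       = refl
  conj (i ∷ is) = cong₂ _∧_ (literal-self σ i) (conj is)

count-and-neg-< : (φ χ : Formula n) (σ : Assignment n) → σ ⊨ φ → σ ⊨ χ →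
                  count n ⟦ φ and neg χ ⟧ < count n ⟦ φ ⟧
count-and-neg-< φ χ σ σ⊨φ σ⊨χ =
  count-mono-< _ (⟦⟧-cong (φ and neg χ)) (⟦⟧-cong φ) (λ _ → ∧-elimˡ) σ
    (cong₂ (λ a b → a ∧ not b) σ⊨φ σ⊨χ) σ⊨φ

_⊨⇒_ : Formula n → Formula n → Set
φ ⊨⇒ χ = ∀ σ → σ ⊨ φ → σ ⊨ χ

gcg-step-decreases : {Φ Φcur Φnext : Formula n} {Holds : Assignment n → Set}
                     {γ : Assignment n → Formula n} →
                     Proper Φ Holds γ → Φcur ⊨⇒ Φ → GCGStep Holds γ Φcur Φnext →
                     Φnext ⊨⇒ Φ × count n ⟦ Φnext ⟧ < count n ⟦ Φcur ⟧
gcg-step-decreases {Φcur = Φcur} _ Φcur⊨⇒Φ (solution σ σ⊨Φcur _) =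
  (λ τ → Φcur⊨⇒Φ τ ∘ ∧-elimˡ) ,
  count-and-neg-< Φcur (minterm σ) σ σ⊨Φcur (minterm-self σ)
gcg-step-decreases {Φcur = Φcur} {γ = γ} proper Φcur⊨⇒Φ (generalize σ σ⊨Φcur ¬Mσ⊨ψ) =
  (λ τ → Φcur⊨⇒Φ τ ∘ ∧-elimˡ) ,
  count-and-neg-< Φcur (γ σ) σ σ⊨Φcur (proj₁ (proper σ (Φcur⊨⇒Φ σ σ⊨Φcur) ¬Mσ⊨ψ))

lemma1 : (n : ℕ) (Φ : Formula n) (Holds : Assignment n → Set)
         (γ : Assignment n → Formula n) →
         Proper Φ Holds γ →
         Acc (GCGSucc Holds γ) Φ
lemma1 n Φ Holds γ proper =
  acc-by-measure (count n ∘ ⟦_⟧) (_⊨⇒ Φ) (gcg-step-decreases {Φ = Φ} proper) (λ _ σ⊨Φ → σ⊨Φ)
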